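{- For every $m$-by-$n$ $(0,1,\ast)$-matrix $A$, $\mathrm{opt}(A)\leq 2^{n-\mathrm{Mr}(A)+\mathrm{cov}(A)}$.
   Context: A $(0,1,\ast)$-matrix has entries in $\{0,1,\ast\}$; arithmetic and ranks are over $GF_2$. A completion of $A$ is obtained by replacing each $\ast$ by $0$ or $1$; $\mathrm{Mr}(A)$ (max-rank) is the maximum rank of a completion. A line of $A$ is a row or a column; $\mathrm{cov}(A)$ is the smallest number of lines covering all $\ast$-entries of $A$. An operator $G=(g_1,\dots,g_m):\{0,1\}^n\to\{0,1\}^m$ is consistent with $A=(a_{ij})$ if each $g_i$ depends only on variables $x_j$ with $a_{ij}=\ast$. A set $L\subseteq\{0,1\}^n$ is a solution for $A$ if there exist a completion $M$ and a consistent $G$ with $M\mathbf{x}=G(\mathbf{x})$ for all $\mathbf{x}\in L$; $\mathrm{opt}(A)$ is the maximum size of a solution. -}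

module Defs where

open import Data.Nat using (ℕ; zero; suc; _+_; _≤_)
open import Data.Bool using (Bool; true; false; _xor_; _∧_)
open import Data.Fin using (Fin; zero; suc)
open import Data.Fin.Subset using (Subset; _∈_; ∣_∣)
open import Data.Vec using (Vec; lookup; tabulate)
open import Data.List using (List; length)
open import Data.List.Relation.Unary.Unique.Propositional using (Unique)
open import Data.List.Membership.Propositional renaming (_∈_ to _∈ₗ_)
open import Data.Product using (Σ; ∃; _×_; _,_)
open import Data.Sum using (_⊎_)
open import Data.Unit using (⊤)
open import Relation.Binary.PropositionalEquality using (_≡_)

data Entry : Set where
  𝟎 𝟏 ∗ : Entry

PMatrix : ℕ → ℕ → Set
PMatrix m n = Fin m → Fin n → Entry

-- a matrix over GF(2) (Bool, with xor as + and ∧ as *)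
BMatrix : ℕ → ℕ → Set
BMatrix m n = Fin m → Fin n → Bool

sumB : ∀ {n} → (Fin n → Bool) → Bool
sumB {zero}  f = false
sumB {suc n} f = f zero xor sumB (λ i → f (suc i))

Agrees : Entry → Bool → Set
Agrees 𝟎 b = b ≡ false
Agrees 𝟏 b = b ≡ true
Agrees ∗ b = ⊤

Completion : ∀ {m n} → PMatrix m n → BMatrix m n → Set
Completion A M = ∀ i j → Agrees (A i j) (M i j)

RowsIndependent : ∀ {m n k} → BMatrix m n → (Fin k → Fin m) → Set
RowsIndependent {k = k} M f =
  (c : Fin k → Bool) →
  (∀ j → sumB (λ t → c t ∧ M (f t) j) ≡ false) →
  ∀ t → c t ≡ false

HasRank : ∀ {m n} → BMatrix m n → ℕ → Set
HasRank {m} M r =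
  (Σ (Fin r → Fin m) λ f → RowsIndependent M f) ×
  (∀ k (f : Fin k → Fin m) → RowsIndependent M f → k ≤ r)

IsMaxRank : ∀ {m n} → PMatrix m n → ℕ → Set
IsMaxRank A r =
  (∃ λ M → Completion A M × HasRank M r) ×
  (∀ M s → Completion A M → HasRank M s → s ≤ r)

Covers : ∀ {m n} → PMatrix m n → Subset m → Subset n → Set
Covers A R C = ∀ i j → A i j ≡ ∗ → (i ∈ R) ⊎ (j ∈ C)

IsCov : ∀ {m n} → PMatrix m n → ℕ → Set
IsCov {m} {n} A c =
  (Σ (Subset m) λ R → Σ (Subset n) λ C → Covers A R C × ∣ R ∣ + ∣ C ∣ ≡ c) ×
  (∀ (R : Subset m) (C : Subset n) → Covers A R C → c ≤ ∣ R ∣ + ∣ C ∣)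

_·_ : ∀ {m n} → BMatrix m n → Vec Bool n → Vec Bool m
M · x = tabulate λ i → sumB (λ j → M i j ∧ lookup x j)

Consistent : ∀ {m n} → PMatrix m n → (Vec Bool n → Vec Bool m) → Set
Consistent {n = n} A G =
  ∀ i (x y : Vec Bool n) →
  (∀ j → A i j ≡ ∗ → lookup x j ≡ lookup y j) →
  lookup (G x) i ≡ lookup (G y) i

IsSolution : ∀ {m n} → PMatrix m n → List (Vec Bool n) → Set
IsSolution {m} {n} A L =
  Unique L ×
  (Σ (BMatrix m n) λ M → Σ (Vec Bool n → Vec Bool m) λ G →
     Completion A M × Consistent A G × (∀ x → x ∈ₗ L → M · x ≡ G x))

IsOpt : ∀ {m n} → PMatrix m n → ℕ → Set
IsOpt A k =
  (∃ λ L → IsSolution A L × length L ≡ k) ×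
  (∀ L → IsSolution A L → length L ≤ k)

module Submission where

-- Fix a completion M₀ of A of maximal rank r with independent rows f, a cover of the ∗-entries
-- by rows R and columns C, and a solution L with completion M and consistent operator G.
-- For a row i ∉ R all ∗-entries of row i lie in C, and M₀ᵢ and Mᵢ differ only at ∗-entries,
-- so on L the value M₀ᵢ·x = G(x)ᵢ ⊕ (M₀ᵢ ⊕ Mᵢ)·x depends only on the C-coordinates of x.
-- Since the rows f are distinct, at least r − |R| of them lie outside R.  It remains to count:
-- if p independent linear forms are determined on a set L ⊆ {0,1}ⁿ by the coordinates in S,
-- then |L|·2ᵖ ≤ 2ⁿ⁺|S|.  This goes by induction on n: Gaussian elimination removes the first
-- coordinate from the forms, losing at most one form (the pivot); if the first coordinate is
-- in S we split L according to it, which the extra factor 2 pays for, and otherwise the pivot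
-- form recovers the first coordinate from the others, so dropping it is injective on L.

open import Defs
open import Algebra.Bundles using (CommutativeRing)
open import Data.Bool using (Bool; true; false; _xor_; _∧_)
open import Data.Bool.Properties as Bool
  using (xor-∧-commutativeRing; xor-identityʳ; xor-same; xor-comm; ∧-zeroʳ; ∧-identityʳ; ∧-assoc;
         ∧-distribˡ-xor; ∧-distribʳ-xor; ¬-not)
open import Data.Fin using (Fin; zero; suc; punchIn)
open import Data.Fin.Properties using (_≟_; any?; punchInᵢ≢i)
open import Data.Fin.Subset using (Subset; _∈_; _∉_; _-_; ∣_∣; inside; outside)
open import Data.Fin.Subset.Properties using (_∈?_; ∣p∣≤∣x∷p∣; x∈p⇒∣p-x∣<∣p∣; x∈p∧x≢y⇒x∈p-y)
open import Data.List using (List; []; _∷_; length; map; filter)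
open import Data.List.Properties using (length-map)
import Data.List.Relation.Unary.All as All
import Data.List.Relation.Unary.All.Properties as All
open import Data.List.Relation.Unary.AllPairs using ([]; _∷_)
import Data.List.Relation.Unary.Any as Any
open import Data.List.Relation.Unary.Unique.Propositional using (Unique)
import Data.List.Relation.Unary.Unique.Propositional.Properties as Unique
open import Data.List.Membership.Propositional using () renaming (_∈_ to _∈ₗ_)
open import Data.List.Membership.Propositional.Properties using (∈-map⁻; ∈-filter⁻)
open import Data.Nat using (ℕ; zero; suc; _+_; _*_; _∸_; _^_; _≤_; z≤n; s≤s)
open import Data.Nat.Properties
  using (≤-refl; ≤-trans; +-assoc; +-comm; +-suc; +-identityʳ; *-assoc; *-comm; *-distribʳ-+;
         m≤m+n; m≤n+m∸n; +-mono-≤; +-monoˡ-≤; +-monoʳ-≤; *-monoˡ-≤; *-monoʳ-≤; *-cancelʳ-≤;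
         ^-monoʳ-≤; ^-distribˡ-+-*; m^n≢0; module ≤-Reasoning)
open import Data.Product using (Σ; ∃; _×_; _,_)
open import Data.Sum using (inj₁; inj₂)
open import Data.Vec using (Vec; []; _∷_; head; tail; lookup; here; there)
open import Data.Vec.Functional using (insertAt)
open import Data.Vec.Functional.Properties using (insertAt-lookup; insertAt-punchIn)
open import Data.Vec.Properties using (lookup∘tabulate)
open import Function using (_∘_; id)
open import Relation.Nullary using (Dec; does; yes; no; contradiction)
open import Relation.Nullary.Decidable using (dec-true; dec-false)
open import Relation.Binary.PropositionalEquality

open import Algebra.Properties.CommutativeSemigroup
  (CommutativeRing.+-commutativeSemigroup xor-∧-commutativeRing)
  using (interchange; x∙yz≈y∙xz)
open import Algebra.Properties.Group
  (CommutativeRing.+-group xor-∧-commutativeRing)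
  using (∙-cancelʳ)

sumB-cong : ∀ {n} {f g : Fin n → Bool} → (∀ i → f i ≡ g i) → sumB f ≡ sumB g
sumB-cong {zero}  f≗g = refl
sumB-cong {suc n} f≗g = cong₂ _xor_ (f≗g zero) (sumB-cong (f≗g ∘ suc))

sumB-false : ∀ n → sumB {n} (λ _ → false) ≡ false
sumB-false zero    = refl
sumB-false (suc n) = sumB-false n

sumB-xor : ∀ {n} (f g : Fin n → Bool) → sumB (λ i → f i xor g i) ≡ sumB f xor sumB g
sumB-xor {zero}  f g = refl
sumB-xor {suc n} f g =
  trans (cong ((f zero xor g zero) xor_) (sumB-xor (f ∘ suc) (g ∘ suc)))
        (interchange (f zero) (g zero) _ _)

sumB-∧ˡ : ∀ {n} a (f : Fin n → Bool) → sumB (λ i → a ∧ f i) ≡ a ∧ sumB f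
sumB-∧ˡ {zero}  a f = sym (∧-zeroʳ a)
sumB-∧ˡ {suc n} a f =
  trans (cong ((a ∧ f zero) xor_) (sumB-∧ˡ a (f ∘ suc))) (sym (∧-distribˡ-xor a _ _))

sumB-∧ʳ : ∀ {n} (f : Fin n → Bool) a → sumB (λ i → f i ∧ a) ≡ sumB f ∧ a
sumB-∧ʳ {zero}  f a = refl
sumB-∧ʳ {suc n} f a =
  trans (cong ((f zero ∧ a) xor_) (sumB-∧ʳ (f ∘ suc) a)) (sym (∧-distribʳ-xor a (f zero) _))

sumB-punchIn : ∀ {n} (t : Fin (suc n)) (f : Fin (suc n) → Bool) →
               sumB f ≡ f t xor sumB (f ∘ punchIn t)
sumB-punchIn         zero    f = refl
sumB-punchIn {suc n} (suc t) f =
  trans (cong (f zero xor_) (sumB-punchIn t (f ∘ suc))) (x∙yz≈y∙xz (f zero) (f (suc t)) _)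

sumB-select : ∀ {n} (t : Fin n) (f : Fin n → Bool) → sumB (λ s → does (s ≟ t) ∧ f s) ≡ f t
sumB-select {suc n} zero    f = trans (cong (f zero xor_) (sumB-false n)) (xor-identityʳ _)
sumB-select         (suc t) f = sumB-select t (f ∘ suc)

xor-cancelʳ : ∀ d {a b} → a xor d ≡ b xor d → a ≡ b
xor-cancelʳ d {a} {b} = ∙-cancelʳ d a b

Independent : ∀ {p n} → (Fin p → Fin n → Bool) → Set
Independent u = RowsIndependent u id

Independent-resp : ∀ {p n} {u v : Fin p → Fin n → Bool} →
                   (∀ t j → u t j ≡ v t j) → Independent u → Independent v
Independent-resp u≗v ind c comb =
  ind c (λ j → trans (sumB-cong (λ t → cong (c t ∧_) (u≗v t j))) (comb j))

Independent-injective : ∀ {p n} {u : Fin p → Fin n → Bool} → Independent u →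
                        ∀ {t t'} → (∀ j → u t j ≡ u t' j) → t ≡ t'
Independent-injective {u = u} ind {t} {t'} same with t ≟ t'
... | yes t≡t' = t≡t'
... | no t≢t' = contradiction (trans (sym c-t) (ind c combination t)) λ ()
  where
  c : Fin _ → Bool
  c s = does (s ≟ t) xor does (s ≟ t')
  combination : ∀ j → sumB (λ s → c s ∧ u s j) ≡ false
  combination j = begin
    sumB (λ s → c s ∧ u s j)
      ≡⟨ sumB-cong (λ s → ∧-distribʳ-xor (u s j) (does (s ≟ t)) _) ⟩
    sumB (λ s → (does (s ≟ t) ∧ u s j) xor (does (s ≟ t') ∧ u s j))
      ≡⟨ sumB-xor (λ s → does (s ≟ t) ∧ u s j) (λ s → does (s ≟ t') ∧ u s j) ⟩
    sumB (λ s → does (s ≟ t) ∧ u s j) xor sumB (λ s → does (s ≟ t') ∧ u s j)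
      ≡⟨ cong₂ _xor_ (sumB-select t _) (sumB-select t' _) ⟩
    u t j xor u t' j
      ≡⟨ cong (_xor u t' j) (same j) ⟩
    u t' j xor u t' j
      ≡⟨ xor-same (u t' j) ⟩
    false ∎
    where open ≡-Reasoning
  c-t : c t ≡ true
  c-t = cong₂ _xor_ (dec-true (t ≟ t) refl) (dec-false (t ≟ t') t≢t')

infixl 6 _⊕_
infixr 7 _⊙_

_⊕_ : ∀ {n} → (Fin n → Bool) → (Fin n → Bool) → Fin n → Bool
(v ⊕ w) j = v j xor w j

_⊙_ : ∀ {n} → Bool → (Fin n → Bool) → Fin n → Bool
(a ⊙ w) j = a ∧ w j

dot : ∀ {n} → (Fin n → Bool) → Vec Bool n → Bool
dot w x = sumB (λ j → w j ∧ lookup x j)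

dot-⊕ : ∀ {n} (v w : Fin n → Bool) x → dot (v ⊕ w) x ≡ dot v x xor dot w x
dot-⊕ v w x =
  trans (sumB-cong (λ j → ∧-distribʳ-xor (lookup x j) (v j) (w j)))
        (sumB-xor (λ j → v j ∧ lookup x j) (λ j → w j ∧ lookup x j))

dot-⊙ : ∀ {n} a (w : Fin n → Bool) x → dot (a ⊙ w) x ≡ a ∧ dot w x
dot-⊙ a w x =
  trans (sumB-cong (λ j → ∧-assoc a (w j) (lookup x j))) (sumB-∧ˡ a (λ j → w j ∧ lookup x j))

dot-suc : ∀ {n} {w : Fin (suc n) → Bool} → w zero ≡ false →
          ∀ x₀ x → dot w (x₀ ∷ x) ≡ dot (w ∘ suc) x
dot-suc {w = w} w₀≡false x₀ x = cong (λ b → (b ∧ x₀) xor dot (w ∘ suc) x) w₀≡false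

dot-agree : ∀ {n} (w : Fin n → Bool) {x y} →
            (∀ j → w j ≡ true → lookup x j ≡ lookup y j) → dot w x ≡ dot w y
dot-agree w {x} {y} agree = sumB-cong term
  where
  term : ∀ j → w j ∧ lookup x j ≡ w j ∧ lookup y j
  term j with w j in wj
  ... | true  = agree j wj
  ... | false = refl

dot-cancel : ∀ {n} (v w : Fin n → Bool) {x y} →
             dot w x ≡ dot w y → dot (v ⊕ w) x ≡ dot (v ⊕ w) y → dot v x ≡ dot v y
dot-cancel v w {x} {y} w-same v⊕w-same = xor-cancelʳ (dot w y) (begin
  dot v x xor dot w y  ≡⟨ cong (dot v x xor_) (sym w-same) ⟩
  dot v x xor dot w x  ≡⟨ sym (dot-⊕ v w x) ⟩
  dot (v ⊕ w) x        ≡⟨ v⊕w-same ⟩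
  dot (v ⊕ w) y        ≡⟨ dot-⊕ v w y ⟩
  dot v y xor dot w y  ∎)
  where open ≡-Reasoning

eliminate : ∀ {q n} → (Fin (suc q) → Fin n → Bool) → Fin (suc q) → (Fin q → Bool) →
            Fin q → Fin n → Bool
eliminate u t a i = u (punchIn t i) ⊕ a i ⊙ u t

sumB-eliminate : ∀ {q n} (u : Fin (suc q) → Fin n → Bool) t a (c : Fin q → Bool) j →
                 sumB (λ i → c i ∧ eliminate u t a i j)
                   ≡ sumB (λ i → c i ∧ u (punchIn t i) j) xor (sumB (λ i → c i ∧ a i) ∧ u t j)
sumB-eliminate u t a c j = begin
  sumB (λ i → c i ∧ (u (punchIn t i) j xor (a i ∧ u t j)))
    ≡⟨ sumB-cong (λ i → ∧-distribˡ-xor (c i) (u (punchIn t i) j) (a i ∧ u t j)) ⟩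
  sumB (λ i → (c i ∧ u (punchIn t i) j) xor (c i ∧ (a i ∧ u t j)))
    ≡⟨ sumB-xor (λ i → c i ∧ u (punchIn t i) j) (λ i → c i ∧ (a i ∧ u t j)) ⟩
  sumB (λ i → c i ∧ u (punchIn t i) j) xor sumB (λ i → c i ∧ (a i ∧ u t j))
    ≡⟨ cong (sumB (λ i → c i ∧ u (punchIn t i) j) xor_)
            (trans (sumB-cong (λ i → sym (∧-assoc (c i) (a i) (u t j))))
                   (sumB-∧ʳ (λ i → c i ∧ a i) (u t j))) ⟩
  sumB (λ i → c i ∧ u (punchIn t i) j) xor (sumB (λ i → c i ∧ a i) ∧ u t j) ∎
  where open ≡-Reasoning

Independent-eliminate : ∀ {q n} {u : Fin (suc q) → Fin n → Bool} t a →
                        Independent u → Independent (eliminate u t a)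
Independent-eliminate {u = u} t a ind c combination i =
  trans (sym (insertAt-punchIn c t α i)) (ind (insertAt c t α) lifted (punchIn t i))
  where
  open ≡-Reasoning
  α : Bool
  α = sumB (λ i → c i ∧ a i)
  lifted : ∀ j → sumB (λ s → insertAt c t α s ∧ u s j) ≡ false
  lifted j = begin
    sumB (λ s → insertAt c t α s ∧ u s j)
      ≡⟨ sumB-punchIn t (λ s → insertAt c t α s ∧ u s j) ⟩
    (insertAt c t α t ∧ u t j) xor sumB (λ i → insertAt c t α (punchIn t i) ∧ u (punchIn t i) j)
      ≡⟨ cong₂ _xor_ (cong (_∧ u t j) (insertAt-lookup c t α))
                     (sumB-cong (λ i → cong (_∧ u (punchIn t i) j) (insertAt-punchIn c t α i))) ⟩
    (α ∧ u t j) xor sumB (λ i → c i ∧ u (punchIn t i) j)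
      ≡⟨ xor-comm (α ∧ u t j) _ ⟩
    sumB (λ i → c i ∧ u (punchIn t i) j) xor (α ∧ u t j)
      ≡⟨ sym (sumB-eliminate u t a c j) ⟩
    sumB (λ i → c i ∧ eliminate u t a i j)
      ≡⟨ combination j ⟩
    false ∎

Independent-punchIn : ∀ {q n} {u : Fin (suc q) → Fin n → Bool} t →
                      Independent u → Independent (u ∘ punchIn t)
Independent-punchIn {u = u} t ind =
  Independent-resp (λ i j → xor-identityʳ (u (punchIn t i) j))
                   (Independent-eliminate {u = u} t (λ _ → false) ind)

Independent-tail : ∀ {p n} {u : Fin p → Fin (suc n) → Bool} → (∀ t → u t zero ≡ false) →
                   Independent u → Independent (λ t j → u t (suc j))
Independent-tail {p} u₀≡false ind c combination = ind c λ where
  zero    → trans (sumB-cong (λ t → trans (cong (c t ∧_) (u₀≡false t)) (∧-zeroʳ (c t))))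
                  (sumB-false p)
  (suc j) → combination j

SameValues : ∀ {p n} → (Fin p → Fin n → Bool) → Vec Bool n → Vec Bool n → Set
SameValues u x y = ∀ t → dot (u t) x ≡ dot (u t) y

SameValues-eliminate : ∀ {q n} {u : Fin (suc q) → Fin n → Bool} t a {x y} →
                       SameValues u x y → SameValues (eliminate u t a) x y
SameValues-eliminate {u = u} t a {x} {y} same i = begin
  dot (eliminate u t a i) x
    ≡⟨ dot-⊕ (u (punchIn t i)) (a i ⊙ u t) x ⟩
  dot (u (punchIn t i)) x xor dot (a i ⊙ u t) x
    ≡⟨ cong₂ _xor_ (same (punchIn t i)) (dot-⊙ (a i) (u t) x) ⟩
  dot (u (punchIn t i)) y xor (a i ∧ dot (u t) x)
    ≡⟨ cong (λ b → dot (u (punchIn t i)) y xor (a i ∧ b)) (same t) ⟩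
  dot (u (punchIn t i)) y xor (a i ∧ dot (u t) y)
    ≡⟨ cong (dot (u (punchIn t i)) y xor_) (sym (dot-⊙ (a i) (u t) y)) ⟩
  dot (u (punchIn t i)) y xor dot (a i ⊙ u t) y
    ≡⟨ sym (dot-⊕ (u (punchIn t i)) (a i ⊙ u t) y) ⟩
  dot (eliminate u t a i) y ∎
  where open ≡-Reasoning

record ColumnReduction {p n} (u : Fin p → Fin (suc n) → Bool) (q : ℕ) : Set where
  field
    reduced     : Fin q → Fin n → Bool
    independent : Independent reduced
    reduces     : ∀ {x₀ x y₀ y} → SameValues u (x₀ ∷ x) (y₀ ∷ y) → SameValues reduced x y

reduceClearedColumn : ∀ {p q n} {u : Fin p → Fin (suc n) → Bool}
                      (v : Fin q → Fin (suc n) → Bool) →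
                  (∀ i → v i zero ≡ false) → Independent v →
                  (∀ {x y} → SameValues u x y → SameValues v x y) → ColumnReduction u q
reduceClearedColumn v v₀≡false ind preserves = record
  { reduced     = λ i j → v i (suc j)
  ; independent = Independent-tail v₀≡false ind
  ; reduces     = λ {x₀} {x} {y₀} {y} same i →
      trans (sym (dot-suc {w = v i} (v₀≡false i) x₀ x))
            (trans (preserves {x₀ ∷ x} {y₀ ∷ y} same i) (dot-suc {w = v i} (v₀≡false i) y₀ y))
  }

reducePivotFree : ∀ {p n} {u : Fin p → Fin (suc n) → Bool} → (∀ t → u t zero ≡ false) →
            Independent u → ColumnReduction u p
reducePivotFree {u = u} u₀≡false ind = reduceClearedColumn u u₀≡false ind id

reducePivot : ∀ {q n} {u : Fin (suc q) → Fin (suc n) → Bool} t → u t zero ≡ true →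
           Independent u → ColumnReduction u q
reducePivot {u = u} t pivot ind =
  reduceClearedColumn (eliminate u t a) cleared
    (Independent-eliminate {u = u} t a ind) (λ {x} {y} → SameValues-eliminate {u = u} t a {x} {y})
  where
  a : Fin _ → Bool
  a i = u (punchIn t i) zero
  cleared : ∀ i → eliminate u t a i zero ≡ false
  cleared i = trans (cong (λ b → a i xor (a i ∧ b)) pivot)
                    (trans (cong (a i xor_) (∧-identityʳ (a i))) (xor-same (a i)))

pivot-determines : ∀ {p n} {u : Fin p → Fin (suc n) → Bool} t → u t zero ≡ true →
                   ∀ {x₀ y₀ x} → SameValues u (x₀ ∷ x) (y₀ ∷ x) → x₀ ≡ y₀
pivot-determines {u = u} t pivot {x₀} {y₀} {x} same =
  xor-cancelʳ (dot (u t ∘ suc) x)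
    (subst (λ b → (b ∧ x₀) xor dot (u t ∘ suc) x ≡ (b ∧ y₀) xor dot (u t ∘ suc) x)
           pivot (same t))

Unique-map⁺ : ∀ {A B : Set} {f : A → B} {xs : List A} →
              (∀ {x y} → x ∈ₗ xs → y ∈ₗ xs → f x ≡ f y → x ≡ y) → Unique xs → Unique (map f xs)
Unique-map⁺ injective [] = []
Unique-map⁺ injective (x∉xs ∷ unique) =
  All.map⁺ (All.tabulate λ y∈xs fx≡fy →
    All.lookup x∉xs y∈xs (injective (Any.here refl) (Any.there y∈xs) fx≡fy))
  ∷ Unique-map⁺ (λ x∈ y∈ → injective (Any.there x∈) (Any.there y∈)) unique

head≟ : ∀ {n} (b : Bool) (x : Vec Bool (suc n)) → Dec (head x ≡ b)
head≟ b x = head x Bool.≟ b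

fiber : ∀ {n} → Bool → List (Vec Bool (suc n)) → List (Vec Bool n)
fiber b L = map tail (filter (head≟ b) L)

length-fibers : ∀ {n} (L : List (Vec Bool (suc n))) →
                length (fiber false L) + length (fiber true L) ≡ length L
length-fibers []                = refl
length-fibers ((false ∷ x) ∷ L) = cong suc (length-fibers L)
length-fibers ((true ∷ x) ∷ L)  = trans (+-suc _ _) (cong suc (length-fibers L))

∈-fiber⁻ : ∀ {n} b {L : List (Vec Bool (suc n))} {x} → x ∈ₗ fiber b L → (b ∷ x) ∈ₗ L
∈-fiber⁻ b {L} x∈ with ∈-map⁻ tail x∈
... | (y₀ ∷ y) , y∈ , refl with ∈-filter⁻ (head≟ b) {xs = L} y∈
... | y∈L , refl = y∈L

fiber-unique : ∀ {n} b {L : List (Vec Bool (suc n))} → Unique L → Unique (fiber b L)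
fiber-unique b {L} unique = Unique-map⁺ tail-injective (Unique.filter⁺ (head≟ b) unique)
  where
  tail-injective : ∀ {x y} → x ∈ₗ filter (head≟ b) L → y ∈ₗ filter (head≟ b) L →
                   tail x ≡ tail y → x ≡ y
  tail-injective {_ ∷ _} {_ ∷ _} x∈ y∈ refl
    with ∈-filter⁻ (head≟ b) {xs = L} x∈ | ∈-filter⁻ (head≟ b) {xs = L} y∈
  ... | _ , refl | _ , refl = refl

AgreeOn : ∀ {n} → Subset n → Vec Bool n → Vec Bool n → Set
AgreeOn S x y = ∀ {j} → j ∈ S → lookup x j ≡ lookup y j

AgreeOn-∷ : ∀ {n s b} {S : Subset n} {x y} → AgreeOn S x y → AgreeOn (s ∷ S) (b ∷ x) (b ∷ y)
AgreeOn-∷ agree here        = refl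
AgreeOn-∷ agree (there j∈S) = agree j∈S

AgreeOn-outside∷ : ∀ {n x₀ y₀} {S : Subset n} {x y} → AgreeOn S x y →
                   AgreeOn (outside ∷ S) (x₀ ∷ x) (y₀ ∷ y)
AgreeOn-outside∷ agree (there j∈S) = agree j∈S

Determines : ∀ {p n} → Subset n → (Fin p → Fin n → Bool) → List (Vec Bool n) → Set
Determines S u L = ∀ {x y} → x ∈ₗ L → y ∈ₗ L → AgreeOn S x y → SameValues u x y

fibers-bound : ∀ {p q n k s} {S : Subset n} {u : Fin p → Fin (suc n) → Bool}
               (r : ColumnReduction u q) →
               (∀ L → Unique L → Determines S (ColumnReduction.reduced r) L →
                length L * 2 ^ q ≤ k) →
               ∀ {L} → Unique L → Determines (s ∷ S) u L → length L * 2 ^ q ≤ 2 * k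
fibers-bound {q = q} {k = k} r bound {L} unique determines = begin
  length L * 2 ^ q
    ≡⟨ cong (_* 2 ^ q) (sym (length-fibers L)) ⟩
  (length (fiber false L) + length (fiber true L)) * 2 ^ q
    ≡⟨ *-distribʳ-+ (2 ^ q) (length (fiber false L)) _ ⟩
  length (fiber false L) * 2 ^ q + length (fiber true L) * 2 ^ q
    ≤⟨ +-mono-≤ (on-fiber false) (on-fiber true) ⟩
  k + k
    ≡⟨ cong (k +_) (sym (+-identityʳ k)) ⟩
  2 * k ∎
  where
  open ≤-Reasoning
  on-fiber : ∀ b → length (fiber b L) * 2 ^ q ≤ k
  on-fiber b = bound (fiber b L) (fiber-unique b unique) λ {x} {y} x∈ y∈ agree →
    ColumnReduction.reduces r {b} {x} {b} {y}
      (determines (∈-fiber⁻ b x∈) (∈-fiber⁻ b y∈) (AgreeOn-∷ agree))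

*-2^suc-≤ : ∀ k q {m} → k * 2 ^ q ≤ m → k * 2 ^ suc q ≤ 2 * m
*-2^suc-≤ k q {m} k*2^q≤m = begin
  k * (2 * 2 ^ q)  ≡⟨ sym (*-assoc k 2 (2 ^ q)) ⟩
  k * 2 * 2 ^ q    ≡⟨ cong (_* 2 ^ q) (*-comm k 2) ⟩
  2 * k * 2 ^ q    ≡⟨ *-assoc 2 k (2 ^ q) ⟩
  2 * (k * 2 ^ q)  ≤⟨ *-monoʳ-≤ 2 k*2^q≤m ⟩
  2 * m            ∎
  where open ≤-Reasoning

determined-length-bound : ∀ n {p} (S : Subset n) (u : Fin p → Fin n → Bool) → Independent u →
                          (L : List (Vec Bool n)) → Unique L → Determines S u L →
                          length L * 2 ^ p ≤ 2 ^ (n + ∣ S ∣)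
determined-length-bound zero {zero}  [] u ind []            _         _ = z≤n
determined-length-bound zero {zero}  [] u ind (_ ∷ [])      _         _ = ≤-refl
determined-length-bound zero {zero}  [] u ind ([] ∷ [] ∷ _) ([]∉ ∷ _) _ =
  contradiction refl (All.head []∉)
determined-length-bound zero {suc p} [] u ind L             _         _ =
  contradiction (ind (λ _ → true) (λ ()) zero) λ ()
determined-length-bound (suc n) {p} (s ∷ S) u ind L unique determines
  with any? (λ t → u t zero Bool.≟ true)
... | no no-pivot =
  ≤-trans (fibers-bound r (λ L' → determined-length-bound n S reduced independent L') unique determines)
          (^-monoʳ-≤ 2 (+-monoʳ-≤ (suc n) (∣p∣≤∣x∷p∣ s S)))
  where
  r : ColumnReduction u p
  r = reducePivotFree {u = u} (λ t → ¬-not (λ pivot → no-pivot (t , pivot))) ind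
  open ColumnReduction r
determined-length-bound (suc n) {suc q} (inside ∷ S) u ind L unique determines | yes (t , pivot) =
  subst (λ e → length L * 2 ^ suc q ≤ 2 * 2 ^ e) (sym (+-suc n ∣ S ∣))
    (*-2^suc-≤ (length L) q
      (fibers-bound r (λ L' → determined-length-bound n S reduced independent L') unique determines))
  where
  r : ColumnReduction u q
  r = reducePivot {u = u} t pivot ind
  open ColumnReduction r
determined-length-bound (suc n) {suc q} (outside ∷ S) u ind L unique determines | yes (t , pivot) =
  *-2^suc-≤ (length L) q (subst (λ l → l * 2 ^ q ≤ 2 ^ (n + ∣ S ∣)) (length-map tail L)
    (determined-length-bound n S reduced independent (map tail L) tails-unique tails-determined))
  where
  open ColumnReduction (reducePivot {u = u} t pivot ind)
  tail-injective : ∀ {x y} → x ∈ₗ L → y ∈ₗ L → tail x ≡ tail y → x ≡ y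
  tail-injective {x₀ ∷ x} {y₀ ∷ .x} x∈ y∈ refl =
    cong (_∷ x) (pivot-determines {u = u} t pivot {x₀} {y₀} {x}
                   (determines x∈ y∈ (AgreeOn-outside∷ λ _ → refl)))
  tails-unique : Unique (map tail L)
  tails-unique = Unique-map⁺ tail-injective unique
  tails-determined : Determines S reduced (map tail L)
  tails-determined x∈ y∈ agree with ∈-map⁻ tail x∈ | ∈-map⁻ tail y∈
  ... | (x₀ ∷ x) , x∈L , refl | (y₀ ∷ y) , y∈L , refl =
    reduces {x₀} {x} {y₀} {y} (determines x∈L y∈L (AgreeOn-outside∷ agree))

rows-avoiding : ∀ {m n r} (M : BMatrix m n) (R : Subset m) (f : Fin r → Fin m) → RowsIndependent M f →
                ∃ λ q → Σ (Fin q → Fin r) λ g →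
                  RowsIndependent M (f ∘ g) × (∀ i → f (g i) ∉ R) × r ≤ q + ∣ R ∣
rows-avoiding {r = r} M R f ind with any? (λ t → f t ∈? R)
... | no none = r , id , ind , (λ t ft∈R → none (t , ft∈R)) , m≤m+n r ∣ R ∣
rows-avoiding {r = suc r} M R f ind | yes (t , ft∈R)
  with rows-avoiding M (R - f t) (f ∘ punchIn t) (Independent-punchIn {u = M ∘ f} t ind)
... | q , g , ind' , avoids , r≤q+∣R-ft∣ = q , punchIn t ∘ g , ind' , avoids-R , bound
  where
  avoids-R : ∀ i → f (punchIn t (g i)) ∉ R
  avoids-R i ∈R = avoids i (x∈p∧x≢y⇒x∈p-y ∈R λ same-row →
    punchInᵢ≢i t (g i)
      (Independent-injective {u = M ∘ f} ind (λ j → cong (λ row → M row j) same-row)))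
  bound : suc r ≤ q + ∣ R ∣
  bound = begin
    suc r                    ≤⟨ s≤s r≤q+∣R-ft∣ ⟩
    suc (q + ∣ R - f t ∣)    ≡⟨ sym (+-suc q _) ⟩
    q + suc ∣ R - f t ∣      ≤⟨ +-monoʳ-≤ q (x∈p⇒∣p-x∣<∣p∣ ft∈R) ⟩
    q + ∣ R ∣                ∎
    where open ≤-Reasoning

Agrees-xor : ∀ {a b b'} → Agrees a b → Agrees a b' → b xor b' ≡ true → a ≡ ∗
Agrees-xor {𝟎} refl refl ()
Agrees-xor {𝟏} refl refl ()
Agrees-xor {∗} _    _    _ = refl

uncovered-row-determined :
  ∀ {m n} {A : PMatrix m n} {R C M₀ M G L i} → Covers A R C → i ∉ R →
  Completion A M₀ → Completion A M → Consistent A G → (∀ x → x ∈ₗ L → M · x ≡ G x) →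
  ∀ {x y} → x ∈ₗ L → y ∈ₗ L → AgreeOn C x y → dot (M₀ i) x ≡ dot (M₀ i) y
uncovered-row-determined {A = A} {M₀ = M₀} {M} {G} {L} {i}
  covers i∉R M₀-completes M-completes consistent solves {x} {y} x∈L y∈L agree =
  dot-cancel (M₀ i) (M i) {x} {y} completed-part difference-part
  where
  agree-on-∗ : ∀ j → A i j ≡ ∗ → lookup x j ≡ lookup y j
  agree-on-∗ j starred with covers i j starred
  ... | inj₁ i∈R = contradiction i∈R i∉R
  ... | inj₂ j∈C = agree j∈C
  value : ∀ {z} → z ∈ₗ L → dot (M i) z ≡ lookup (G z) i
  value {z} z∈L =
    trans (sym (lookup∘tabulate (λ i → dot (M i) z) i)) (cong (λ v → lookup v i) (solves z z∈L))
  completed-part : dot (M i) x ≡ dot (M i) y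
  completed-part = trans (value x∈L) (trans (consistent i x y agree-on-∗) (sym (value y∈L)))
  difference-part : dot (M₀ i ⊕ M i) x ≡ dot (M₀ i ⊕ M i) y
  difference-part = dot-agree (M₀ i ⊕ M i) {x} {y} λ j differ →
    agree-on-∗ j (Agrees-xor (M₀-completes i j) (M-completes i j) differ)

2^-exponent-bound : ∀ k n p r a b → k * 2 ^ p ≤ 2 ^ (n + b) → r ≤ p + a →
                    k ≤ 2 ^ (n ∸ r + (a + b))
2^-exponent-bound k n p r a b k*2^p≤2^[n+b] r≤p+a =
  *-cancelʳ-≤ k (2 ^ (n ∸ r + (a + b))) (2 ^ r) {{m^n≢0 2 r}} (begin
    k * 2 ^ r                      ≤⟨ *-monoʳ-≤ k (^-monoʳ-≤ 2 r≤p+a) ⟩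
    k * 2 ^ (p + a)                ≡⟨ cong (k *_) (^-distribˡ-+-* 2 p a) ⟩
    k * (2 ^ p * 2 ^ a)            ≡⟨ sym (*-assoc k (2 ^ p) (2 ^ a)) ⟩
    k * 2 ^ p * 2 ^ a              ≤⟨ *-monoˡ-≤ (2 ^ a) k*2^p≤2^[n+b] ⟩
    2 ^ (n + b) * 2 ^ a            ≡⟨ sym (^-distribˡ-+-* 2 (n + b) a) ⟩
    2 ^ (n + b + a)                ≡⟨ cong (2 ^_) (trans (+-assoc n b a) (cong (n +_) (+-comm b a))) ⟩
    2 ^ (n + (a + b))              ≤⟨ ^-monoʳ-≤ 2 (+-monoˡ-≤ (a + b) (m≤n+m∸n n r)) ⟩
    2 ^ (r + (n ∸ r) + (a + b))    ≡⟨ cong (2 ^_) (+-assoc r (n ∸ r) (a + b)) ⟩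
    2 ^ (r + (n ∸ r + (a + b)))    ≡⟨ ^-distribˡ-+-* 2 r (n ∸ r + (a + b)) ⟩
    2 ^ r * 2 ^ (n ∸ r + (a + b))  ≡⟨ *-comm (2 ^ r) _ ⟩
    2 ^ (n ∸ r + (a + b)) * 2 ^ r  ∎)
  where open ≤-Reasoning

lemma8 : (m n : ℕ) (A : PMatrix m n) (r c k : ℕ) →
    IsMaxRank A r → IsCov A c → IsOpt A k →
    k ≤ 2 ^ (n ∸ r + c)
lemma8 m n A r c k ((M₀ , M₀-completes , (f , f-independent) , _) , _)
                   ((R , C , covers , ∣R∣+∣C∣≡c) , _)
                   ((L , (L-unique , M , G , M-completes , G-consistent , solves) , ∣L∣≡k) , _)
  with rows-avoiding M₀ R f f-independent
... | q , g , independent , avoids , r≤q+∣R∣ =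
  subst₂ (λ l e → l ≤ 2 ^ (n ∸ r + e)) ∣L∣≡k ∣R∣+∣C∣≡c
    (2^-exponent-bound (length L) n q r ∣ R ∣ ∣ C ∣
      (determined-length-bound n C (M₀ ∘ f ∘ g) independent L L-unique λ x∈L y∈L agree i →
        uncovered-row-determined covers (avoids i) M₀-completes M-completes G-consistent solves
          x∈L y∈L agree)
      r≤q+∣R∣)
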